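{- For every $n\in\mathbb{N}$, \[ \sum_{\substack{k=1\\ \gcd(k,n)=1}}^{n}\gcd(k^2-1,n)=\phi(n)\,h(n), \] where \[ h(n)=\begin{cases}\tau(m^2),& n=m\text{ odd},\\ 2\tau(m^2),& n=2m,\ m\text{ odd},\\ 4(\ell-1)\tau(m^2),& n=2^{\ell}m,\ \ell\ge 2,\ m\text{ odd}.\end{cases} \]
   Context: $\mathbb{N}=\{1,2,\ldots\}$; $\phi$ is Euler's totient function; $\tau(n)$ is the number of positive divisors of $n$; $\gcd(0,n)=n$. -}

module Defs where

open import Data.Nat using (ℕ; zero; suc; _+_; _*_; _∸_)
open import Data.Nat.GCD using (gcd)
open import Data.Nat.Divisibility using (_∣?_)
open import Data.Nat using (_≟_)
open import Data.List using (List; map; filter; length; upTo)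
open import Data.Nat.ListAction using (sum)
open import Data.Nat.Divisibility using (_∣_)
open import Relation.Nullary using (¬_)
open import Relation.Nullary.Decidable using (Dec)

range1 : ℕ → List ℕ
range1 n = map suc (upTo n)

φ : ℕ → ℕ
φ n = length (filter (λ k → gcd k n ≟ 1) (range1 n))

τ : ℕ → ℕ
τ n = length (filter (λ d → d ∣? n) (range1 n))

-- S(n) = Σ_{1 ≤ k ≤ n, gcd(k,n)=1} gcd(k^2 - 1, n)
-- (k ≥ 1, so k*k ∸ 1 is the true k^2 - 1; gcd 0 n = n as in the paper)
S : ℕ → ℕ
S n = sum (map (λ k → gcd (k * k ∸ 1) n) (filter (λ k → gcd k n ≟ 1) (range1 n)))

Odd : ℕ → Set
Odd m = ¬ (2 ∣ m)

module Submission where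

-- Strategy: S and φ are multiplicative, so it suffices to know the "average"
-- S(q)/φ(q) on prime powers q and to multiply these averages.
--  * Finite sums ∑ f n = f 0 + … + f (n - 1) and indicators 𝟙 come first, with
--    reindexing along an injection, summing along a bijection, and counting a
--    property by listing its witnesses.
--  * S, φ, τ are rewritten as sums over the residues 0, …, n - 1 (S′, φ′, τ′).
--  * Multiplicativity: for coprime a, b the Chinese remainder theorem makes
--    k ↦ (k mod a, k mod b) a bijection, and gcd(k, ab) = gcd(k, a) gcd(k, b)
--    factors the summands; τ is multiplicative via d ↦ (gcd(d, a), gcd(d, b)).
--  * Prime powers: gcd(x, p^(e+1)) = gcd(x, p^e) + [p^(e+1) ∣ x] φ(p^(e+1))
--    gives S(p^(e+2)) = p S(p^(e+1)) + φ(p^(e+2)) R(p^(e+2)), where R counts the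
--    square roots of 1.  R(p^(e+1)) = 2 for odd p and R(2^(e+3)) = 4, so the
--    average is 2e + 3 = τ(p^(2e+2)) on odd p^(e+1) and 4(l + 1) on 2^(l+2).
--  * Odd m are assembled from coprime prime powers by well-founded induction;
--    the even cases multiply by one power of 2.

open import Defs
open import Data.Nat using (ℕ; _*_; _∸_; _^_; _≤_; _<_; _≥_; suc)
open import Data.Product using (_×_)
open import Relation.Binary.PropositionalEquality using (_≡_)

open import Data.Bool using (true; false)
open import Data.Nat
open import Data.Nat.Properties
open import Data.Nat.Divisibility
open import Data.Nat.DivMod
open import Data.Nat.GCD
open import Data.Nat.Coprimality using (Coprime; coprime-divisor; coprime⇒gcd≡1) renaming (sym to coprime-sym)
open import Data.Nat.Primality using (Prime; prime[2]; prime⇒nonZero; prime⇒nonTrivial; prime⇒irreducible)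
open import Data.Nat.Primality.Factorisation using (factorise)
open import Data.Nat.Induction using (<-rec)
open import Data.Nat.ListAction using (sum; product)
open import Data.Nat.Solver using (module +-*-Solver)
open import Data.List using (List; []; _∷_; map; filter; length; applyUpTo)
open import Data.List.Properties using (map-applyUpTo)
open import Data.List.Membership.Propositional using (_∈_)
open import Data.List.Relation.Unary.All using (All; []; _∷_) renaming (lookup to All-lookup)
open import Data.List.Relation.Unary.AllPairs using (AllPairs; []; _∷_) renaming (map to AllPairs-map)
open import Data.List.Relation.Unary.Any using (here; there)
open import Data.List.Relation.Unary.Linked using (Linked; []; [-]; _∷_)
open import Data.List.Relation.Unary.Linked.Properties using (Linked⇒AllPairs)
open import Data.Product using (∃-syntax; _,_; proj₁; proj₂)
open import Data.Sum using (_⊎_; inj₁; inj₂)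
open import Data.Empty using (⊥-elim)
open import Function using (_∘_)
open import Relation.Nullary using (¬_; Dec; yes; no; _because_; contradiction; ¬?)
open import Relation.Nullary.Decidable using (_×-dec_)
open import Relation.Unary using (Decidable)
open import Relation.Binary.PropositionalEquality using (refl; sym; trans; cong; cong₂; subst; _≢_; module ≡-Reasoning)
open +-*-Solver using (solve; _:+_; _:*_; _:=_; con)

-- 𝟙 d is 1 when the decided proposition holds and 0 otherwise.  It inspects
-- only the boolean part of d, so e.g. 𝟙 (suc t ≟ 0) reduces to 0.
𝟙 : {A : Set} → Dec A → ℕ
𝟙 (true  because _) = 1
𝟙 (false because _) = 0

𝟙-yes : {A : Set} → A → (d : Dec A) → 𝟙 d ≡ 1
𝟙-yes _ (yes _) = refl
𝟙-yes a (no ¬a) = ⊥-elim (¬a a)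

𝟙-no : {A : Set} → ¬ A → (d : Dec A) → 𝟙 d ≡ 0
𝟙-no ¬a (yes a) = ⊥-elim (¬a a)
𝟙-no _  (no _)  = refl

𝟙-⇔ : {A B : Set} → (A → B) → (B → A) → (dA : Dec A) (dB : Dec B) → 𝟙 dA ≡ 𝟙 dB
𝟙-⇔ to _    (yes a) dB = sym (𝟙-yes (to a) dB)
𝟙-⇔ _  from (no ¬a) dB = sym (𝟙-no (¬a ∘ from) dB)

𝟙-× : {A B : Set} (dA : Dec A) (dB : Dec B) → 𝟙 (dA ×-dec dB) ≡ 𝟙 dA * 𝟙 dB
𝟙-× (yes _) (yes _) = refl
𝟙-× (yes _) (no _)  = refl
𝟙-× (no _)  _       = refl

∑ : (ℕ → ℕ) → ℕ → ℕ
∑ f zero    = 0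
∑ f (suc n) = f 0 + ∑ (f ∘ suc) n

∑-cong : ∀ {f g : ℕ → ℕ} n → (∀ k → k < n → f k ≡ g k) → ∑ f n ≡ ∑ g n
∑-cong zero    _  = refl
∑-cong (suc n) eq = cong₂ _+_ (eq 0 z<s) (∑-cong n (λ k k<n → eq (suc k) (s<s k<n)))

∑-const : ∀ c n → ∑ (λ _ → c) n ≡ n * c
∑-const c zero    = refl
∑-const c (suc n) = cong (c +_) (∑-const c n)

∑-zero : ∀ (f : ℕ → ℕ) n → (∀ k → k < n → f k ≡ 0) → ∑ f n ≡ 0
∑-zero f n f≡0 = trans (∑-cong n f≡0) (trans (∑-const 0 n) (*-zeroʳ n))

∑-+ : ∀ (f g : ℕ → ℕ) n → ∑ (λ k → f k + g k) n ≡ ∑ f n + ∑ g n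
∑-+ f g zero    = refl
∑-+ f g (suc n) = trans (cong (f 0 + g 0 +_) (∑-+ (f ∘ suc) (g ∘ suc) n))
  (solve 4 (λ a b c d → (a :+ b) :+ (c :+ d) := (a :+ c) :+ (b :+ d)) refl (f 0) (g 0) (∑ (f ∘ suc) n) (∑ (g ∘ suc) n))

∑-*ˡ : ∀ c (f : ℕ → ℕ) n → ∑ (λ k → c * f k) n ≡ c * ∑ f n
∑-*ˡ c f zero    = sym (*-zeroʳ c)
∑-*ˡ c f (suc n) = trans (cong (c * f 0 +_) (∑-*ˡ c (f ∘ suc) n)) (sym (*-distribˡ-+ c (f 0) _))

∑-*ʳ : ∀ c (f : ℕ → ℕ) n → ∑ (λ k → f k * c) n ≡ ∑ f n * c
∑-*ʳ c f n = trans (∑-cong n (λ k _ → *-comm (f k) c)) (trans (∑-*ˡ c f n) (*-comm c _))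

∑-last : ∀ (f : ℕ → ℕ) n → ∑ f (suc n) ≡ ∑ f n + f n
∑-last f zero    = +-comm (f 0) 0
∑-last f (suc n) = trans (cong (f 0 +_) (∑-last (f ∘ suc) n)) (sym (+-assoc (f 0) _ _))

∑-rotate : ∀ (f : ℕ → ℕ) n → f n ≡ f 0 → ∑ (f ∘ suc) n ≡ ∑ f n
∑-rotate f n fn≡f0 = +-cancelˡ-≡ (f 0) _ _ (begin
  ∑ f (suc n)     ≡⟨ ∑-last f n ⟩
  ∑ f n + f n     ≡⟨ cong (∑ f n +_) fn≡f0 ⟩
  ∑ f n + f 0     ≡⟨ +-comm (∑ f n) (f 0) ⟩
  f 0 + ∑ f n     ∎)
  where open ≡-Reasoning

∑-split : ∀ (f : ℕ → ℕ) m n → ∑ f (m + n) ≡ ∑ f m + ∑ (λ k → f (m + k)) n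
∑-split f zero    n = refl
∑-split f (suc m) n = trans (cong (f 0 +_) (∑-split (f ∘ suc) m n)) (sym (+-assoc (f 0) _ _))

∑-swap : ∀ (h : ℕ → ℕ → ℕ) m n → ∑ (λ i → ∑ (h i) n) m ≡ ∑ (λ j → ∑ (λ i → h i j) m) n
∑-swap h zero    n = sym (∑-zero _ n (λ _ _ → refl))
∑-swap h (suc m) n = trans (cong (∑ (h 0) n +_) (∑-swap (h ∘ suc) m n)) (sym (∑-+ (h 0) _ n))

∑-rows : ∀ (f : ℕ → ℕ) a b → ∑ f (a * b) ≡ ∑ (λ i → ∑ (λ j → f (i * b + j)) b) a
∑-rows f zero    b = refl
∑-rows f (suc a) b = begin
  ∑ f (b + a * b)                                         ≡⟨ ∑-split f b (a * b) ⟩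
  ∑ f b + ∑ (λ k → f (b + k)) (a * b)                     ≡⟨ cong (∑ f b +_) (∑-rows (λ k → f (b + k)) a b) ⟩
  ∑ f b + ∑ (λ i → ∑ (λ j → f (b + (i * b + j))) b) a     ≡⟨ cong (∑ f b +_) (∑-cong a (λ i _ → ∑-cong b (λ j _ → cong f (sym (+-assoc b (i * b) j))))) ⟩
  ∑ f b + ∑ (λ i → ∑ (λ j → f (b + i * b + j)) b) a       ∎
  where open ≡-Reasoning

∑-periodic : ∀ (f : ℕ → ℕ) N → (∀ k → f (k + N) ≡ f k) → ∀ c → ∑ f (c * N) ≡ c * ∑ f N
∑-periodic f N periodic zero    = refl
∑-periodic f N periodic (suc c) = trans (∑-split f N (c * N))
  (cong (∑ f N +_) (trans (∑-cong (c * N) (λ k _ → trans (cong f (+-comm N k)) (periodic k))) (∑-periodic f N periodic c)))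

∑-point : ∀ (W : ℕ → ℕ) c n → c < n → ∑ (λ t → 𝟙 (t ≟ c) * W t) n ≡ W c
∑-point W zero    (suc n) _         = trans (cong₂ _+_ (*-identityˡ (W 0)) (∑-zero _ n (λ _ _ → refl))) (+-identityʳ (W 0))
∑-point W (suc c) (suc n) (s<s c<n) =
  trans (∑-cong n (λ t _ → cong (_* W (suc t)) (𝟙-⇔ suc-injective (cong suc) (suc t ≟ suc c) (t ≟ c))))
        (∑-point (W ∘ suc) c n c<n)

count-point : ∀ c n → c < n → ∑ (λ t → 𝟙 (t ≟ c)) n ≡ 1
count-point c n c<n = trans (∑-cong n (λ t _ → sym (*-identityʳ (𝟙 (t ≟ c))))) (∑-point (λ _ → 1) c n c<n)

count≤1 : ∀ {P : ℕ → Set} (P? : ∀ k → Dec (P k)) n →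
  (∀ k k′ → k < n → k′ < n → P k → P k′ → k ≡ k′) → ∑ (𝟙 ∘ P?) n ≤ 1
count≤1 P? zero    _    = z≤n
count≤1 P? (suc n) uniq with P? 0
... | yes P0 = ≤-reflexive (cong suc (∑-zero _ n (λ k k<n → 𝟙-no (λ Pk → 0≢1+n (uniq 0 (suc k) z<s (s<s k<n) P0 Pk)) (P? (suc k)))))
... | no _   = count≤1 (P? ∘ suc) n (λ k k′ k<n k′<n Pk Pk′ → suc-injective (uniq (suc k) (suc k′) (s<s k<n) (s<s k′<n) Pk Pk′))

∑-bounded : ∀ (f : ℕ → ℕ) n → (∀ k → k < n → f k ≤ 1) → ∑ f n ≤ n
∑-bounded f zero    _   = z≤n
∑-bounded f (suc n) f≤1 = +-mono-≤ (f≤1 0 z<s) (∑-bounded (f ∘ suc) n (λ k k<n → f≤1 (suc k) (s<s k<n)))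

∑-all-ones : ∀ (f : ℕ → ℕ) n → (∀ k → k < n → f k ≤ 1) → ∑ f n ≡ n → ∀ k → k < n → f k ≡ 1
∑-all-ones f (suc n) f≤1 total with m≤n⇒m<n∨m≡n (f≤1 0 z<s)
... | inj₁ f0<1 = ⊥-elim (1+n≰n (begin
      suc n                ≡⟨ sym total ⟩
      f 0 + ∑ (f ∘ suc) n  ≡⟨ cong (_+ ∑ (f ∘ suc) n) (n≤0⇒n≡0 (s≤s⁻¹ f0<1)) ⟩
      ∑ (f ∘ suc) n        ≤⟨ ∑-bounded (f ∘ suc) n tail≤1 ⟩
      n                    ∎))
  where
  open ≤-Reasoning
  tail≤1 : ∀ k → k < n → f (suc k) ≤ 1
  tail≤1 k k<n = f≤1 (suc k) (s<s k<n)
... | inj₂ f0≡1 = λ where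
  zero    _         → f0≡1
  (suc k) (s<s k<n) → ∑-all-ones (f ∘ suc) n (λ j j<n → f≤1 (suc j) (s<s j<n))
                        (suc-injective (trans (cong (_+ ∑ (f ∘ suc) n) (sym f0≡1)) total)) k k<n

-- An injective self-map σ of {0, …, N-1} permutes the terms of a sum.  Each
-- fibre of σ has at most one element and the fibre sizes add up to N, so every
-- fibre is a singleton.
∑-reindex : ∀ N (σ W : ℕ → ℕ) → (∀ k → k < N → σ k < N) →
  (∀ k k′ → k < N → k′ < N → σ k ≡ σ k′ → k ≡ k′) → ∑ (W ∘ σ) N ≡ ∑ W N
∑-reindex N σ W σ< σ-injective = begin
  ∑ (W ∘ σ) N                                   ≡⟨ ∑-cong N (λ k k<N → sym (∑-point W (σ k) N (σ< k k<N))) ⟩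
  ∑ (λ k → ∑ (λ t → 𝟙 (t ≟ σ k) * W t) N) N     ≡⟨ ∑-swap (λ k t → 𝟙 (t ≟ σ k) * W t) N N ⟩
  ∑ (λ t → ∑ (λ k → 𝟙 (t ≟ σ k) * W t) N) N     ≡⟨ ∑-cong N (λ t _ → ∑-*ʳ (W t) (λ k → 𝟙 (t ≟ σ k)) N) ⟩
  ∑ (λ t → fibre t * W t) N                     ≡⟨ ∑-cong N (λ t t<N → trans (cong (_* W t) (fibre≡1 t t<N)) (*-identityˡ (W t))) ⟩
  ∑ W N                                         ∎
  where
  open ≡-Reasoning
  fibre : ℕ → ℕ
  fibre t = ∑ (λ k → 𝟙 (t ≟ σ k)) N
  fibre≤1 : ∀ t → t < N → fibre t ≤ 1
  fibre≤1 t _ = count≤1 (λ k → t ≟ σ k) N (λ k k′ k<N k′<N t≡σk t≡σk′ → σ-injective k k′ k<N k′<N (trans (sym t≡σk) t≡σk′))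
  fibres : ∑ fibre N ≡ N
  fibres = begin
    ∑ fibre N                                   ≡⟨ ∑-swap (λ t k → 𝟙 (t ≟ σ k)) N N ⟩
    ∑ (λ k → ∑ (λ t → 𝟙 (t ≟ σ k)) N) N         ≡⟨ ∑-cong N (λ k k<N → count-point (σ k) N (σ< k k<N)) ⟩
    ∑ (λ _ → 1) N                               ≡⟨ trans (∑-const 1 N) (*-identityʳ N) ⟩
    N                                           ∎
  fibre≡1 : ∀ t → t < N → fibre t ≡ 1
  fibre≡1 = ∑-all-ones fibre N fibre≤1 fibres

-- Weighted sums along a bijection x ↦ f x between {x < N | P x} and
-- {y < M | Q y} with inverse g: both sides are the sum of W y over the graph.
∑-bij : ∀ {P Q : ℕ → Set} (P? : ∀ x → Dec (P x)) (Q? : ∀ y → Dec (Q y)) N M (f g W : ℕ → ℕ) →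
  (∀ x → x < N → P x → f x < M) →
  (∀ y → y < M → Q y → g y < N) →
  (∀ x y → x < N → y < M → P x × y ≡ f x → Q y × x ≡ g y) →
  (∀ x y → x < N → y < M → Q y × x ≡ g y → P x × y ≡ f x) →
  ∑ (λ x → 𝟙 (P? x) * W (f x)) N ≡ ∑ (λ y → 𝟙 (Q? y) * W y) M
∑-bij P? Q? N M f g W f< g< to from = begin
  ∑ (λ x → 𝟙 (P? x) * W (f x)) N                                ≡⟨ ∑-cong N (λ x x<N → sym (row x x<N)) ⟩
  ∑ (λ x → ∑ (λ y → 𝟙 (P? x ×-dec (y ≟ f x)) * W y) M) N        ≡⟨ ∑-cong N (λ x x<N → ∑-cong M (λ y y<M → cong (_* W y) (graph x y x<N y<M))) ⟩
  ∑ (λ x → ∑ (λ y → 𝟙 (Q? y ×-dec (x ≟ g y)) * W y) M) N        ≡⟨ ∑-swap (λ x y → 𝟙 (Q? y ×-dec (x ≟ g y)) * W y) N M ⟩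
  ∑ (λ y → ∑ (λ x → 𝟙 (Q? y ×-dec (x ≟ g y)) * W y) N) M        ≡⟨ ∑-cong M column ⟩
  ∑ (λ y → 𝟙 (Q? y) * W y) M                                    ∎
  where
  open ≡-Reasoning
  graph : ∀ x y → x < N → y < M → 𝟙 (P? x ×-dec (y ≟ f x)) ≡ 𝟙 (Q? y ×-dec (x ≟ g y))
  graph x y x<N y<M = 𝟙-⇔ (to x y x<N y<M) (from x y x<N y<M) _ _
  row : ∀ x → x < N → ∑ (λ y → 𝟙 (P? x ×-dec (y ≟ f x)) * W y) M ≡ 𝟙 (P? x) * W (f x)
  row x x<N with P? x
  ... | yes Px = begin
    ∑ (λ y → 𝟙 (yes Px ×-dec (y ≟ f x)) * W y) M ≡⟨ ∑-cong M (λ y _ → cong (_* W y) (trans (𝟙-× (yes Px) (y ≟ f x)) (*-identityˡ _))) ⟩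
    ∑ (λ y → 𝟙 (y ≟ f x) * W y) M               ≡⟨ ∑-point W (f x) M (f< x x<N Px) ⟩
    W (f x)                                     ≡⟨ sym (*-identityˡ (W (f x))) ⟩
    1 * W (f x)                                 ∎
  ... | no _   = ∑-zero _ M (λ _ _ → refl)
  column : ∀ y → y < M → ∑ (λ x → 𝟙 (Q? y ×-dec (x ≟ g y)) * W y) N ≡ 𝟙 (Q? y) * W y
  column y y<M with Q? y
  ... | yes Qy = begin
    ∑ (λ x → 𝟙 (yes Qy ×-dec (x ≟ g y)) * W y) N ≡⟨ ∑-cong N (λ x _ → cong (_* W y) (trans (𝟙-× (yes Qy) (x ≟ g y)) (*-identityˡ _))) ⟩
    ∑ (λ x → 𝟙 (x ≟ g y) * W y) N               ≡⟨ ∑-*ʳ (W y) (λ x → 𝟙 (x ≟ g y)) N ⟩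
    ∑ (λ x → 𝟙 (x ≟ g y)) N * W y               ≡⟨ cong (_* W y) (count-point (g y) N (g< y y<M Qy)) ⟩
    1 * W y                                     ∎
  ... | no _   = ∑-zero _ N (λ _ _ → refl)

∑-sum-map : ∀ (h : ℕ → ℕ → ℕ) N (cs : List ℕ) →
  ∑ (λ k → sum (map (h k) cs)) N ≡ sum (map (λ c → ∑ (λ k → h k c) N) cs)
∑-sum-map h N []       = ∑-zero _ N (λ _ _ → refl)
∑-sum-map h N (c ∷ cs) = trans (∑-+ (λ k → h k c) (λ k → sum (map (h k) cs)) N) (cong (∑ (λ k → h k c) N +_) (∑-sum-map h N cs))

occurrences : ℕ → List ℕ → ℕ
occurrences k cs = sum (map (λ c → 𝟙 (k ≟ c)) cs)

occurrences-∉ : ∀ k cs → ¬ k ∈ cs → occurrences k cs ≡ 0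
occurrences-∉ k []       _   = refl
occurrences-∉ k (c ∷ cs) k∉ = cong₂ _+_ (𝟙-no (k∉ ∘ here) (k ≟ c)) (occurrences-∉ k cs (k∉ ∘ there))

occurrences-∈ : ∀ k cs → AllPairs _≢_ cs → k ∈ cs → occurrences k cs ≡ 1
occurrences-∈ k (c ∷ cs) (c≢cs ∷ _)        (here refl) = cong₂ _+_ (𝟙-yes refl (k ≟ c)) (occurrences-∉ k cs (λ k∈ → All-lookup c≢cs k∈ refl))
occurrences-∈ k (c ∷ cs) (c≢cs ∷ distinct) (there k∈)  = cong₂ _+_ (𝟙-no (λ k≡c → All-lookup c≢cs k∈ (sym k≡c)) (k ≟ c)) (occurrences-∈ k cs distinct k∈)

count-by-listing : ∀ {P : ℕ → Set} (P? : ∀ k → Dec (P k)) N (cs : List ℕ) → Linked _<_ cs → All (_< N) cs →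
  All P cs → (∀ k → k < N → P k → k ∈ cs) → ∑ (𝟙 ∘ P?) N ≡ length cs
count-by-listing P? N cs increasing below witnesses complete = begin
  ∑ (𝟙 ∘ P?) N                                   ≡⟨ ∑-cong N indicator≡occurrences ⟩
  ∑ (λ k → occurrences k cs) N                   ≡⟨ ∑-sum-map (λ k c → 𝟙 (k ≟ c)) N cs ⟩
  sum (map (λ c → ∑ (λ k → 𝟙 (k ≟ c)) N) cs)     ≡⟨ each-once cs below ⟩
  length cs                                      ∎
  where
  open ≡-Reasoning
  distinct : AllPairs _≢_ cs
  distinct = AllPairs-map <⇒≢ (Linked⇒AllPairs <-trans increasing)
  indicator≡occurrences : ∀ k → k < N → 𝟙 (P? k) ≡ occurrences k cs
  indicator≡occurrences k k<N with P? k
  ... | yes Pk = sym (occurrences-∈ k cs distinct (complete k k<N Pk))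
  ... | no ¬Pk = sym (occurrences-∉ k cs (¬Pk ∘ All-lookup witnesses))
  each-once : ∀ ds → All (_< N) ds → sum (map (λ c → ∑ (λ k → 𝟙 (k ≟ c)) N) ds) ≡ length ds
  each-once []       []              = refl
  each-once (d ∷ ds) (d<N ∷ ds<N)    = cong₂ _+_ (count-point d N d<N) (each-once ds ds<N)

gcd-unique : ∀ {m n g} → g ∣ m → g ∣ n → (∀ {d} → d ∣ m → d ∣ n → d ∣ g) → gcd m n ≡ g
gcd-unique {m} {n} g∣m g∣n greatest = ∣-antisym (greatest (gcd[m,n]∣m m n) (gcd[m,n]∣n m n)) (gcd-greatest g∣m g∣n)

gcd-of-multiple : ∀ {m n} → n ∣ m → gcd m n ≡ n
gcd-of-multiple n∣m = gcd-unique n∣m ∣-refl (λ _ d∣n → d∣n)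

gcd-+mul : ∀ x t n → gcd (x + t * n) n ≡ gcd x n
gcd-+mul x t n = gcd-unique (∣m∣n⇒∣m+n (gcd[m,n]∣m x n) (∣n⇒∣m*n t (gcd[m,n]∣n x n))) (gcd[m,n]∣n x n)
  (λ {d} d∣x+tn d∣n → gcd-greatest (∣m+n∣m⇒∣n (subst (d ∣_) (+-comm x (t * n)) d∣x+tn) (∣n⇒∣m*n t d∣n)) d∣n)

gcd-mod : ∀ x n .{{_ : NonZero n}} → gcd (x % n) n ≡ gcd x n
gcd-mod x n = trans (sym (gcd-+mul (x % n) (x / n) n)) (cong (λ y → gcd y n) (sym (m≡m%n+[m/n]*n x n)))

∣-small : ∀ {d x} → d ∣ x → x < d → x ≡ 0
∣-small {x = zero}  _   _   = refl
∣-small {x = suc _} d∣x x<d = contradiction d∣x (>⇒∤ x<d)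

coprime-∣ˡ : ∀ {a b c} → Coprime a b → c ∣ a → Coprime c b
coprime-∣ˡ coprime c∣a (d∣c , d∣b) = coprime (∣-trans d∣c c∣a , d∣b)

coprime-∣ʳ : ∀ {a b c} → Coprime a b → c ∣ b → Coprime a c
coprime-∣ʳ coprime c∣b (d∣a , d∣c) = coprime (d∣a , ∣-trans d∣c c∣b)

coprime-* : ∀ {a b c} → Coprime a b → Coprime a c → Coprime a (b * c)
coprime-* cab cac (d∣a , d∣bc) = cac (d∣a , coprime-divisor (coprime-∣ˡ cab d∣a) d∣bc)

coprime-^ : ∀ {x} p e → Coprime x p → Coprime x (p ^ e)
coprime-^ p zero    _      (_ , d∣1) = ∣1⇒≡1 d∣1
coprime-^ p (suc e) coprime          = coprime-* coprime (coprime-^ p e coprime)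

coprime-product-∣ : ∀ {u v x} → Coprime u v → u ∣ x → v ∣ x → u * v ∣ x
coprime-product-∣ {u} {v} cuv (divides s refl) v∣su with coprime-divisor (coprime-sym cuv) (subst (v ∣_) (*-comm s u) v∣su)
... | divides r refl = divides r (trans (*-assoc r v u) (cong (r *_) (*-comm v u)))

-- Every common divisor d of x and ab divides gcd(x, b) · gcd(x, a), since
-- a · gcd(x, b) = gcd(ax, ab) and gcd(x, b) · gcd(x, a) = gcd(gcd(x, b) x, gcd(x, b) a).
gcd-mult : ∀ x {a b} → Coprime a b → gcd x (a * b) ≡ gcd x a * gcd x b
gcd-mult x {a} {b} cab = gcd-unique product∣x (*-pres-∣ (gcd[m,n]∣n x a) (gcd[m,n]∣n x b)) greatest
  where
  product∣x : gcd x a * gcd x b ∣ x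
  product∣x = coprime-product-∣ (coprime-∣ʳ (coprime-∣ˡ cab (gcd[m,n]∣n x a)) (gcd[m,n]∣n x b)) (gcd[m,n]∣m x a) (gcd[m,n]∣m x b)
  greatest : ∀ {d} → d ∣ x → d ∣ a * b → d ∣ gcd x a * gcd x b
  greatest {d} d∣x d∣ab = subst (d ∣_) (trans (sym (c*gcd[m,n]≡gcd[cm,cn] (gcd x b) x a)) (*-comm (gcd x b) (gcd x a)))
                            (gcd-greatest (∣n⇒∣m*n (gcd x b) d∣x) (subst (d ∣_) (*-comm a (gcd x b)) d∣a*gcd[x,b]))
    where
    d∣a*gcd[x,b] : d ∣ a * gcd x b
    d∣a*gcd[x,b] = subst (d ∣_) (sym (c*gcd[m,n]≡gcd[cm,cn] a x b)) (gcd-greatest (∣n⇒∣m*n a d∣x) d∣ab)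

gcd-coprime-factor : ∀ u {v a} → Coprime v a → gcd (u * v) a ≡ gcd u a
gcd-coprime-factor u {v} cva = gcd-unique (∣-trans (gcd[m,n]∣m u _) (m∣m*n v)) (gcd[m,n]∣n u _)
  (λ {d} d∣uv d∣a → gcd-greatest (coprime-divisor (coprime-sym (coprime-∣ʳ cva d∣a)) (subst (d ∣_) (*-comm u v) d∣uv)) d∣a)

prime>1 : ∀ {p} → Prime p → 1 < p
prime>1 {p} pp = nonTrivial⇒n>1 p {{prime⇒nonTrivial pp}}

prime-coprime : ∀ {p x} → Prime p → ¬ p ∣ x → Coprime p x
prime-coprime pp p∤x (d∣p , d∣x) with prime⇒irreducible pp d∣p
... | inj₁ d≡1 = d≡1
... | inj₂ refl = ⊥-elim (p∤x d∣x)

prime-to-p⇒unit : ∀ {p k} → Prime p → ¬ p ∣ k → ∀ n → gcd k (p ^ n) ≡ 1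
prime-to-p⇒unit {p} pp p∤k n = coprime⇒gcd≡1 (coprime-^ p n (coprime-sym (prime-coprime pp p∤k)))

unit⇒prime-to-p : ∀ {p k} → Prime p → ∀ e → gcd k (p ^ suc e) ≡ 1 → ¬ p ∣ k
unit⇒prime-to-p {p} pp e unit p∣k = <⇒≢ (prime>1 pp) (sym (∣1⇒≡1 (subst (p ∣_) unit (gcd-greatest p∣k (m∣m*n (p ^ e))))))

prime-power-∣ : ∀ {p a b} → Prime p → ¬ p ∣ a → ∀ n → p ^ n ∣ a * b → p ^ n ∣ b
prime-power-∣ {p} pp p∤a n = coprime-divisor (coprime-sym (coprime-^ p n (coprime-sym (prime-coprime pp p∤a))))

pow-∣ : ∀ p {i j} → i ≤ j → p ^ i ∣ p ^ j
pow-∣ p {i} {j} i≤j = divides (p ^ (j ∸ i)) (trans (cong (p ^_) (sym (m+[n∸m]≡n i≤j)))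
                        (trans (^-distribˡ-+-* p i (j ∸ i)) (*-comm (p ^ i) (p ^ (j ∸ i)))))

pow<pow-suc : ∀ {p} → Prime p → ∀ n → p ^ n < p ^ suc n
pow<pow-suc {p} pp n = subst (_< p ^ suc n) (*-identityˡ (p ^ n)) (*-monoˡ-< (p ^ n) {{m^n≢0 p n {{prime⇒nonZero pp}}}} (prime>1 pp))

pow-divisor : ∀ {p} → Prime p → ∀ n {d} → d ∣ p ^ n → ∃[ i ] (i ≤ n × d ≡ p ^ i)
pow-divisor pp zero    d∣1 = 0 , z≤n , ∣1⇒≡1 d∣1
pow-divisor {p} pp (suc n) {d} d∣ with p ∣? d
... | no p∤d with pow-divisor pp n (coprime-divisor (coprime-sym (prime-coprime pp p∤d)) d∣)
...   | i , i≤n , d≡ = i , m≤n⇒m≤1+n i≤n , d≡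
pow-divisor {p} pp (suc n) d∣ | yes (divides d′ refl)
  with pow-divisor pp n (*-cancelˡ-∣ p {{prime⇒nonZero pp}} (subst (_∣ p * p ^ n) (*-comm d′ p) d∣))
... | i , i≤n , refl = suc i , s≤s i≤n , *-comm (p ^ i) p

pow-divisor-step : ∀ {p} → Prime p → ∀ n {d} → d ∣ p ^ suc n → d ∣ p ^ n ⊎ d ≡ p ^ suc n
pow-divisor-step {p} pp n d∣ with pow-divisor pp (suc n) d∣
... | i , i≤ , refl with m≤n⇒m<n∨m≡n i≤
...   | inj₁ (s≤s i≤n) = inj₁ (pow-∣ p i≤n)
...   | inj₂ refl      = inj₂ refl

gcd-pow-step : ∀ {p} → Prime p → ∀ x e →
  gcd x (p ^ suc e) ≡ gcd x (p ^ e) + 𝟙 (p ^ suc e ∣? x) * (p ^ suc e ∸ p ^ e)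
gcd-pow-step {p} pp x e with p ^ suc e ∣? x
... | yes q∣x = begin
  gcd x (p ^ suc e)                           ≡⟨ gcd-of-multiple q∣x ⟩
  p ^ suc e                                   ≡⟨ sym (m+[n∸m]≡n (<⇒≤ (pow<pow-suc pp e))) ⟩
  p ^ e + (p ^ suc e ∸ p ^ e)                 ≡⟨ cong₂ _+_ (sym (gcd-of-multiple (∣-trans (pow-∣ p (n≤1+n e)) q∣x))) (sym (*-identityˡ _)) ⟩
  gcd x (p ^ e) + 1 * (p ^ suc e ∸ p ^ e)     ∎
  where open ≡-Reasoning
... | no q∤x = trans (sym (gcd-unique (gcd[m,n]∣m x (p ^ suc e)) g∣p^e greatest)) (sym (+-identityʳ _))
  where
  g∣p^e : gcd x (p ^ suc e) ∣ p ^ e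
  g∣p^e with pow-divisor-step pp e (gcd[m,n]∣n x (p ^ suc e))
  ... | inj₁ g∣ = g∣
  ... | inj₂ g≡ = ⊥-elim (q∤x (subst (_∣ x) g≡ (gcd[m,n]∣m x (p ^ suc e))))
  greatest : ∀ {d} → d ∣ x → d ∣ p ^ e → d ∣ gcd x (p ^ suc e)
  greatest d∣x d∣p^e = gcd-greatest d∣x (∣-trans d∣p^e (pow-∣ p (n≤1+n e)))

gcd-square-mod : ∀ k n .{{_ : NonZero n}} → 1 ≤ k % n → gcd (k * k ∸ 1) n ≡ gcd ((k % n) * (k % n) ∸ 1) n
gcd-square-mod k n r≥1 = begin
  gcd (k * k ∸ 1) n                                 ≡⟨ cong (λ y → gcd (y * y ∸ 1) n) (m≡m%n+[m/n]*n k n) ⟩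
  gcd ((r + q * n) * (r + q * n) ∸ 1) n             ≡⟨ cong (λ y → gcd y n) (expand r≥1) ⟩
  gcd ((r * r ∸ 1) + (2 * r * q + q * q * n) * n) n ≡⟨ gcd-+mul (r * r ∸ 1) (2 * r * q + q * q * n) n ⟩
  gcd (r * r ∸ 1) n                                 ∎
  where
  open ≡-Reasoning
  r = k % n
  q = k / n
  expand : ∀ {r} → 1 ≤ r → (r + q * n) * (r + q * n) ∸ 1 ≡ (r * r ∸ 1) + (2 * r * q + q * q * n) * n
  expand {suc r} _ = cong (_∸ 1) (solve 3 (λ r q n → (r :+ q :* n) :* (r :+ q :* n) := r :* r :+ (con 2 :* r :* q :+ q :* q :* n) :* n) refl (suc r) q n)

gcd-square-mod-unit : ∀ k n .{{_ : NonZero n}} → gcd k n ≡ 1 → gcd (k * k ∸ 1) n ≡ gcd ((k % n) * (k % n) ∸ 1) n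
gcd-square-mod-unit k (suc zero)      _    = trans (gcd-zeroʳ (k * k ∸ 1)) (sym (gcd-zeroʳ ((k % 1) * (k % 1) ∸ 1)))
gcd-square-mod-unit k n@(suc (suc _)) unit = gcd-square-mod k n (n≢0⇒n>0 r≢0)
  where
  r≢0 : k % n ≢ 0
  r≢0 r≡0 = 0≢1+n (suc-injective (begin
    1              ≡⟨ sym unit ⟩
    gcd k n        ≡⟨ sym (gcd-mod k n) ⟩
    gcd (k % n) n  ≡⟨ cong (λ r → gcd r n) r≡0 ⟩
    gcd 0 n        ≡⟨ gcd-identityˡ n ⟩
    n              ∎))
    where open ≡-Reasoning

unit : ℕ → ℕ → ℕ
unit n k = 𝟙 (gcd k n ≟ 1)

summand : ℕ → ℕ → ℕ
summand n k = unit n k * gcd (k * k ∸ 1) n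

-- S, φ and τ as sums over 0, …, n - 1 (for τ, x stands for the candidate divisor x + 1).
S′ : ℕ → ℕ
S′ n = ∑ (summand n) n

φ′ : ℕ → ℕ
φ′ n = ∑ (unit n) n

τ′ : ℕ → ℕ
τ′ n = ∑ (λ x → 𝟙 (suc x ∣? n)) n

unit-mod : ∀ n k .{{_ : NonZero n}} → unit n (k % n) ≡ unit n k
unit-mod n k = cong (λ g → 𝟙 (g ≟ 1)) (gcd-mod k n)

unit-weighted : ∀ n k {x y} → (gcd k n ≡ 1 → x ≡ y) → unit n k * x ≡ unit n k * y
unit-weighted n k {x} {y} x≡y = at (gcd k n ≟ 1)
  where
  at : (d : Dec (gcd k n ≡ 1)) → 𝟙 d * x ≡ 𝟙 d * y
  at (yes u) = cong (1 *_) (x≡y u)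
  at (no _)  = refl

summand-mod : ∀ n k .{{_ : NonZero n}} → summand n (k % n) ≡ summand n k
summand-mod n k = trans (cong (_* gcd ((k % n) * (k % n) ∸ 1) n) (unit-mod n k))
                        (unit-weighted n k (λ u → sym (gcd-square-mod-unit k n u)))

unit-periodic : ∀ n .{{_ : NonZero n}} k → unit n (k + n) ≡ unit n k
unit-periodic n k = trans (sym (unit-mod n (k + n))) (trans (cong (unit n) ([m+n]%n≡m%n k n)) (unit-mod n k))

summand-periodic : ∀ n .{{_ : NonZero n}} k → summand n (k + n) ≡ summand n k
summand-periodic n k = trans (sym (summand-mod n (k + n))) (trans (cong (summand n) ([m+n]%n≡m%n k n)) (summand-mod n k))

sum-filter : ∀ {P : ℕ → Set} (P? : Decidable P) (g : ℕ → ℕ) xs →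
  sum (map g (filter P? xs)) ≡ sum (map (λ k → 𝟙 (P? k) * g k) xs)
sum-filter P? g []       = refl
sum-filter P? g (x ∷ xs) with P? x
... | yes _ = cong₂ _+_ (sym (*-identityˡ (g x))) (sum-filter P? g xs)
... | no _  = sum-filter P? g xs

length-filter : ∀ {P : ℕ → Set} (P? : Decidable P) xs → length (filter P? xs) ≡ sum (map (𝟙 ∘ P?) xs)
length-filter P? []       = refl
length-filter P? (x ∷ xs) with P? x
... | yes _ = cong suc (length-filter P? xs)
... | no _  = length-filter P? xs

sum-applyUpTo : ∀ (h g : ℕ → ℕ) n → sum (map h (applyUpTo g n)) ≡ ∑ (h ∘ g) n
sum-applyUpTo h g zero    = refl
sum-applyUpTo h g (suc n) = cong (h (g 0) +_) (sum-applyUpTo h (g ∘ suc) n)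

sum-range1 : ∀ (h : ℕ → ℕ) n → sum (map h (range1 n)) ≡ ∑ (h ∘ suc) n
sum-range1 h n = trans (cong (sum ∘ map h) (map-applyUpTo (λ k → k) suc n)) (sum-applyUpTo h suc n)

-- The definitions of S, φ, τ sum over 1, …, n; by periodicity the term at n
-- may be replaced by the term at 0.
S≡S′ : ∀ n .{{_ : NonZero n}} → S n ≡ S′ n
S≡S′ n = begin
  S n                               ≡⟨ sum-filter (λ k → gcd k n ≟ 1) (λ k → gcd (k * k ∸ 1) n) (range1 n) ⟩
  sum (map (summand n) (range1 n))  ≡⟨ sum-range1 (summand n) n ⟩
  ∑ (summand n ∘ suc) n             ≡⟨ ∑-rotate (summand n) n (summand-periodic n 0) ⟩
  S′ n                              ∎
  where open ≡-Reasoning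

φ≡φ′ : ∀ n .{{_ : NonZero n}} → φ n ≡ φ′ n
φ≡φ′ n = trans (length-filter (λ k → gcd k n ≟ 1) (range1 n))
               (trans (sum-range1 (unit n) n) (∑-rotate (unit n) n (unit-periodic n 0)))

τ≡τ′ : ∀ n → τ n ≡ τ′ n
τ≡τ′ n = trans (length-filter (λ d → d ∣? n) (range1 n)) (sum-range1 (λ d → 𝟙 (d ∣? n)) n)

[i*b+j]/b≡i : ∀ i j b .{{_ : NonZero b}} → j < b → (i * b + j) / b ≡ i
[i*b+j]/b≡i i j b j<b = trans (+-distrib-/-∣ˡ j (n∣m*n i)) (trans (cong₂ _+_ (m*n/n≡m i b) (m<n⇒m/n≡0 j<b)) (+-identityʳ i))

[i*b+j]%b≡j : ∀ i j b .{{_ : NonZero b}} → j < b → (i * b + j) % b ≡ j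
[i*b+j]%b≡j i j b j<b = trans (cong (_% b) (+-comm (i * b) j)) (trans ([m+kn]%n≡m%n j i b) (m<n⇒m%n≡m j<b))

i*b+j<a*b : ∀ {i j a b} → i < a → j < b → i * b + j < a * b
i*b+j<a*b {i} {j} {a} {b} i<a j<b = begin-strict
  i * b + j  <⟨ +-monoʳ-< (i * b) j<b ⟩
  i * b + b  ≡⟨ +-comm (i * b) b ⟩
  suc i * b  ≤⟨ *-monoˡ-≤ b i<a ⟩
  a * b      ∎
  where open ≤-Reasoning

∑-divmod : ∀ a b .{{_ : NonZero b}} (F G : ℕ → ℕ) → ∑ (λ t → F (t / b) * G (t % b)) (a * b) ≡ ∑ F a * ∑ G b
∑-divmod a b F G = begin
  ∑ (λ t → F (t / b) * G (t % b)) (a * b)                         ≡⟨ ∑-rows _ a b ⟩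
  ∑ (λ i → ∑ (λ j → F ((i * b + j) / b) * G ((i * b + j) % b)) b) a ≡⟨ ∑-cong a (λ i _ → ∑-cong b (λ j j<b →
                                                                       cong₂ _*_ (cong F ([i*b+j]/b≡i i j b j<b)) (cong G ([i*b+j]%b≡j i j b j<b)))) ⟩
  ∑ (λ i → ∑ (λ j → F i * G j) b) a                               ≡⟨ ∑-cong a (λ i _ → ∑-*ˡ (F i) G b) ⟩
  ∑ (λ i → F i * ∑ G b) a                                         ≡⟨ ∑-*ʳ (∑ G b) F a ⟩
  ∑ F a * ∑ G b                                                   ∎
  where open ≡-Reasoning

%-≡⇒∣∸ : ∀ k k′ n .{{_ : NonZero n}} → k % n ≡ k′ % n → n ∣ k′ ∸ k
%-≡⇒∣∸ k k′ n eq = divides (k′ / n ∸ k / n) (begin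
  k′ ∸ k                                         ≡⟨ cong₂ _∸_ (m≡m%n+[m/n]*n k′ n) (m≡m%n+[m/n]*n k n) ⟩
  (k′ % n + k′ / n * n) ∸ (k % n + k / n * n)     ≡⟨ cong (λ r → (k′ % n + k′ / n * n) ∸ (r + k / n * n)) eq ⟩
  (k′ % n + k′ / n * n) ∸ (k′ % n + k / n * n)    ≡⟨ [m+n]∸[m+o]≡n∸o (k′ % n) _ _ ⟩
  k′ / n * n ∸ k / n * n                         ≡⟨ sym (*-distribʳ-∸ n (k′ / n) (k / n)) ⟩
  (k′ / n ∸ k / n) * n                           ∎)
  where open ≡-Reasoning

crt-injective-≤ : ∀ {a b} .{{_ : NonZero a}} .{{_ : NonZero b}} → Coprime a b → ∀ {k k′} → k ≤ k′ → k′ < a * b →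
  k % a ≡ k′ % a → k % b ≡ k′ % b → k ≡ k′
crt-injective-≤ {a} {b} cab {k} {k′} k≤k′ k′<ab ≡a ≡b = ≤-antisym k≤k′ (m∸n≡0⇒m≤n difference≡0)
  where
  difference≡0 : k′ ∸ k ≡ 0
  difference≡0 = ∣-small (coprime-product-∣ cab (%-≡⇒∣∸ k k′ a ≡a) (%-≡⇒∣∸ k k′ b ≡b)) (≤-<-trans (m∸n≤m k′ k) k′<ab)

crt-injective : ∀ {a b} .{{_ : NonZero a}} .{{_ : NonZero b}} → Coprime a b → ∀ {k k′} → k < a * b → k′ < a * b →
  k % a ≡ k′ % a → k % b ≡ k′ % b → k ≡ k′
crt-injective cab {k} {k′} k<ab k′<ab ≡a ≡b with ≤-total k k′
... | inj₁ k≤k′ = crt-injective-≤ cab k≤k′ k′<ab ≡a ≡b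
... | inj₂ k′≤k = sym (crt-injective-≤ cab k′≤k k<ab (sym ≡a) (sym ≡b))

-- Chinese remainder theorem, summed: for coprime a and b, the map
-- k ↦ (k mod a) b + (k mod b) permutes {0, …, ab - 1}.
crt-sum : ∀ a b .{{_ : NonZero a}} .{{_ : NonZero b}} → Coprime a b → ∀ (F G : ℕ → ℕ) →
  ∑ (λ k → F (k % a) * G (k % b)) (a * b) ≡ ∑ F a * ∑ G b
crt-sum a b cab F G = begin
  ∑ (λ k → F (k % a) * G (k % b)) (a * b)   ≡⟨ ∑-cong (a * b) (λ k _ → sym (W∘σ k)) ⟩
  ∑ (W ∘ σ) (a * b)                         ≡⟨ ∑-reindex (a * b) σ W (λ k _ → i*b+j<a*b (m%n<n k a) (m%n<n k b)) σ-injective ⟩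
  ∑ W (a * b)                               ≡⟨ ∑-divmod a b F G ⟩
  ∑ F a * ∑ G b                             ∎
  where
  open ≡-Reasoning
  σ : ℕ → ℕ
  σ k = k % a * b + k % b
  W : ℕ → ℕ
  W t = F (t / b) * G (t % b)
  σ/b : ∀ k → σ k / b ≡ k % a
  σ/b k = [i*b+j]/b≡i (k % a) (k % b) b (m%n<n k b)
  σ%b : ∀ k → σ k % b ≡ k % b
  σ%b k = [i*b+j]%b≡j (k % a) (k % b) b (m%n<n k b)
  W∘σ : ∀ k → W (σ k) ≡ F (k % a) * G (k % b)
  W∘σ k = cong₂ _*_ (cong F (σ/b k)) (cong G (σ%b k))
  σ-injective : ∀ k k′ → k < a * b → k′ < a * b → σ k ≡ σ k′ → k ≡ k′
  σ-injective k k′ k<ab k′<ab σk≡σk′ = crt-injective cab k<ab k′<ab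
    (trans (sym (σ/b k)) (trans (cong (_/ b) σk≡σk′) (σ/b k′)))
    (trans (sym (σ%b k)) (trans (cong (_% b) σk≡σk′) (σ%b k′)))

unit-mult : ∀ {a b} → Coprime a b → ∀ k → unit (a * b) k ≡ unit a k * unit b k
unit-mult {a} {b} cab k = trans (𝟙-⇔ split join (gcd k (a * b) ≟ 1) ((gcd k a ≟ 1) ×-dec (gcd k b ≟ 1)))
                                (𝟙-× (gcd k a ≟ 1) (gcd k b ≟ 1))
  where
  split : gcd k (a * b) ≡ 1 → gcd k a ≡ 1 × gcd k b ≡ 1
  split u = m*n≡1⇒m≡1 (gcd k a) (gcd k b) product≡1 , m*n≡1⇒n≡1 (gcd k a) (gcd k b) product≡1
    where product≡1 = trans (sym (gcd-mult k cab)) u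
  join : gcd k a ≡ 1 × gcd k b ≡ 1 → gcd k (a * b) ≡ 1
  join (ua , ub) = trans (gcd-mult k cab) (cong₂ _*_ ua ub)

summand-mult : ∀ {a b} → Coprime a b → ∀ k → summand (a * b) k ≡ summand a k * summand b k
summand-mult {a} {b} cab k = begin
  unit (a * b) k * gcd x (a * b)                ≡⟨ cong₂ _*_ (unit-mult cab k) (gcd-mult x cab) ⟩
  (unit a k * unit b k) * (gcd x a * gcd x b)   ≡⟨ solve 4 (λ u v g h → (u :* v) :* (g :* h) := (u :* g) :* (v :* h)) refl
                                                     (unit a k) (unit b k) (gcd x a) (gcd x b) ⟩
  (unit a k * gcd x a) * (unit b k * gcd x b)   ∎
  where
  open ≡-Reasoning
  x = k * k ∸ 1

S′-mult : ∀ a b .{{_ : NonZero a}} .{{_ : NonZero b}} → Coprime a b → S′ (a * b) ≡ S′ a * S′ b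
S′-mult a b cab = trans (∑-cong (a * b) (λ k _ → trans (summand-mult cab k) (sym (cong₂ _*_ (summand-mod a k) (summand-mod b k)))))
                        (crt-sum a b cab (summand a) (summand b))

φ′-mult : ∀ a b .{{_ : NonZero a}} .{{_ : NonZero b}} → Coprime a b → φ′ (a * b) ≡ φ′ a * φ′ b
φ′-mult a b cab = trans (∑-cong (a * b) (λ k _ → trans (unit-mult cab k) (sym (cong₂ _*_ (unit-mod a k) (unit-mod b k)))))
                        (crt-sum a b cab (unit a) (unit b))

suc-pred-gcd : ∀ x n → suc (pred (gcd (suc x) n)) ≡ gcd (suc x) n
suc-pred-gcd x n = suc-pred (gcd (suc x) n) {{≢-nonZero (gcd[m,n]≢0 (suc x) n (inj₁ (λ ())))}}

-- τ is multiplicative: for coprime a and b the divisors d of ab correspond to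
-- the pairs (gcd(d, a), gcd(d, b)) of divisors of a and b, with inverse
-- (d₁, d₂) ↦ d₁ d₂.  A divisor d is indexed by d - 1, a pair by (d₁ - 1) b + (d₂ - 1).
τ′-mult : ∀ a b .{{_ : NonZero a}} .{{_ : NonZero b}} → Coprime a b → τ′ (a * b) ≡ τ′ a * τ′ b
τ′-mult a b cab = begin
  τ′ (a * b)                                                       ≡⟨ ∑-cong (a * b) (λ x _ → sym (*-identityʳ _)) ⟩
  ∑ (λ x → 𝟙 (suc x ∣? a * b) * 1) (a * b)                          ≡⟨ ∑-bij (λ x → suc x ∣? a * b) pair? (a * b) (a * b)
                                                                        encode decode (λ _ → 1) encode< decode< encode-correct decode-correct ⟩
  ∑ (λ y → 𝟙 (pair? y) * 1) (a * b)                                 ≡⟨ ∑-cong (a * b) (λ y _ → trans (*-identityʳ _) (𝟙-× (suc (y / b) ∣? a) (suc (y % b) ∣? b))) ⟩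
  ∑ (λ y → 𝟙 (suc (y / b) ∣? a) * 𝟙 (suc (y % b) ∣? b)) (a * b)     ≡⟨ ∑-divmod a b (λ i → 𝟙 (suc i ∣? a)) (λ j → 𝟙 (suc j ∣? b)) ⟩
  τ′ a * τ′ b                                                      ∎
  where
  open ≡-Reasoning
  IsPair : ℕ → Set
  IsPair y = suc (y / b) ∣ a × suc (y % b) ∣ b
  pair? : ∀ y → Dec (IsPair y)
  pair? y = (suc (y / b) ∣? a) ×-dec (suc (y % b) ∣? b)
  encode : ℕ → ℕ
  encode x = pred (gcd (suc x) a) * b + pred (gcd (suc x) b)
  decode : ℕ → ℕ
  decode y = pred (suc (y / b) * suc (y % b))
  pred-gcd< : ∀ x n .{{_ : NonZero n}} → pred (gcd (suc x) n) < n
  pred-gcd< x n = subst (_≤ n) (sym (suc-pred-gcd x n)) (gcd[m,n]≤n (suc x) n)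
  encode/b : ∀ x → suc (encode x / b) ≡ gcd (suc x) a
  encode/b x = trans (cong suc ([i*b+j]/b≡i (pred (gcd (suc x) a)) _ b (pred-gcd< x b))) (suc-pred-gcd x a)
  encode%b : ∀ x → suc (encode x % b) ≡ gcd (suc x) b
  encode%b x = trans (cong suc ([i*b+j]%b≡j (pred (gcd (suc x) a)) _ b (pred-gcd< x b))) (suc-pred-gcd x b)
  encode< : ∀ x → x < a * b → suc x ∣ a * b → encode x < a * b
  encode< x _ _ = i*b+j<a*b (pred-gcd< x a) (pred-gcd< x b)
  decode< : ∀ y → y < a * b → IsPair y → decode y < a * b
  decode< y _ (d₁∣a , d₂∣b) = *-mono-≤ (∣⇒≤ d₁∣a) (∣⇒≤ d₂∣b)
  encode-correct : ∀ x y → x < a * b → y < a * b → suc x ∣ a * b × y ≡ encode x → IsPair y × x ≡ decode y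
  encode-correct x y _ _ (d∣ab , refl) =
    (subst (_∣ a) (sym (encode/b x)) (gcd[m,n]∣n (suc x) a) , subst (_∣ b) (sym (encode%b x)) (gcd[m,n]∣n (suc x) b)) ,
    cong pred (begin
      suc x                                               ≡⟨ sym (trans (gcd-comm (suc x) (a * b)) (gcd-of-multiple d∣ab)) ⟩
      gcd (suc x) (a * b)                                 ≡⟨ gcd-mult (suc x) cab ⟩
      gcd (suc x) a * gcd (suc x) b                       ≡⟨ sym (cong₂ _*_ (encode/b x) (encode%b x)) ⟩
      suc (encode x / b) * suc (encode x % b)             ∎)
  decode-correct : ∀ x y → x < a * b → y < a * b → IsPair y × x ≡ decode y → suc x ∣ a * b × y ≡ encode x
  decode-correct x y _ _ ((d₁∣a , d₂∣b) , refl) = *-pres-∣ d₁∣a d₂∣b , (begin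
      y                                                    ≡⟨ trans (m≡m%n+[m/n]*n y b) (+-comm (y % b) _) ⟩
      y / b * b + y % b                                    ≡⟨ sym (cong₂ (λ i j → pred i * b + pred j) gcd-a gcd-b) ⟩
      pred (gcd (d₁ * d₂) a) * b + pred (gcd (d₁ * d₂) b)  ∎)
    where
    d₁ = suc (y / b)
    d₂ = suc (y % b)
    gcd-a : gcd (d₁ * d₂) a ≡ d₁
    gcd-a = trans (gcd-coprime-factor d₁ (coprime-∣ˡ (coprime-sym cab) d₂∣b)) (trans (gcd-comm d₁ a) (gcd-of-multiple d₁∣a))
    gcd-b : gcd (d₁ * d₂) b ≡ d₂
    gcd-b = trans (cong (λ d → gcd d b) (*-comm d₁ d₂))
                  (trans (gcd-coprime-factor d₂ (coprime-∣ˡ cab d₁∣a)) (trans (gcd-comm d₂ b) (gcd-of-multiple d₂∣b)))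

p≤p^suc : ∀ {p} → Prime p → ∀ e → p ≤ p ^ suc e
p≤p^suc {p} pp e = m≤m*n p (p ^ e) {{m^n≢0 p e {{prime⇒nonZero pp}}}}

unit-pp : ∀ {p} → Prime p → ∀ e k → unit (p ^ suc e) k ≡ 𝟙 (¬? (p ∣? k))
unit-pp {p} pp e k = 𝟙-⇔ (unit⇒prime-to-p pp e) (λ p∤k → prime-to-p⇒unit pp p∤k (suc e)) (gcd k (p ^ suc e) ≟ 1) (¬? (p ∣? k))

non-multiple-periodic : ∀ n k → 𝟙 (¬? (n ∣? k + n)) ≡ 𝟙 (¬? (n ∣? k))
non-multiple-periodic n k = 𝟙-⇔ (λ n∤k+n n∣k → n∤k+n (∣m∣n⇒∣m+n n∣k ∣-refl))
                                (λ n∤k n∣k+n → n∤k (∣m+n∣m⇒∣n (subst (n ∣_) (+-comm k n) n∣k+n) ∣-refl)) _ _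

count-non-multiples : ∀ n → ∑ (λ k → 𝟙 (¬? (n ∣? k))) n ≡ n ∸ 1
count-non-multiples zero    = refl
count-non-multiples (suc n) = cong₂ _+_ (𝟙-no (λ n∤0 → n∤0 (suc n ∣0)) (¬? (suc n ∣? 0)))
  (trans (∑-cong n (λ k k<n → 𝟙-yes (>⇒∤ (s<s k<n)) (¬? (suc n ∣? suc k)))) (trans (∑-const 1 n) (*-identityʳ n)))

φ′-pp : ∀ {p} → Prime p → ∀ e → φ′ (p ^ suc e) ≡ p ^ e * (p ∸ 1)
φ′-pp {p} pp e = begin
  ∑ (unit (p ^ suc e)) (p * p ^ e)   ≡⟨ ∑-cong (p * p ^ e) (λ k _ → unit-pp pp e k) ⟩
  ∑ prime-to-p (p * p ^ e)           ≡⟨ cong (∑ prime-to-p) (*-comm p (p ^ e)) ⟩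
  ∑ prime-to-p (p ^ e * p)           ≡⟨ ∑-periodic prime-to-p p (non-multiple-periodic p) (p ^ e) ⟩
  p ^ e * ∑ prime-to-p p             ≡⟨ cong (p ^ e *_) (count-non-multiples p) ⟩
  p ^ e * (p ∸ 1)                    ∎
  where
  open ≡-Reasoning
  prime-to-p : ℕ → ℕ
  prime-to-p k = 𝟙 (¬? (p ∣? k))

φ′-pp-step : ∀ {p} → Prime p → ∀ e → φ′ (p ^ suc (suc e)) ≡ p * φ′ (p ^ suc e)
φ′-pp-step {p} pp e = trans (φ′-pp pp (suc e)) (trans (*-assoc p (p ^ e) (p ∸ 1)) (cong (p *_) (sym (φ′-pp pp e))))

φ′-pp-gap : ∀ {p} → Prime p → ∀ e → p ^ suc e ∸ p ^ e ≡ φ′ (p ^ suc e)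
φ′-pp-gap {p} pp e = begin
  p * p ^ e ∸ p ^ e          ≡⟨ cong₂ _∸_ (*-comm p (p ^ e)) (sym (*-identityʳ (p ^ e))) ⟩
  p ^ e * p ∸ p ^ e * 1      ≡⟨ sym (*-distribˡ-∸ (p ^ e) p 1) ⟩
  p ^ e * (p ∸ 1)            ≡⟨ sym (φ′-pp pp e) ⟩
  φ′ (p ^ suc e)             ∎
  where open ≡-Reasoning

-- The divisors x + 1 of p^(n+1) are those of p^n (all with x < p^n) and p^(n+1) itself.
τ′-pp : ∀ {p} → Prime p → ∀ n → τ′ (p ^ n) ≡ suc n
τ′-pp pp zero = refl
τ′-pp {p} pp (suc n) = begin
  ∑ f q                                  ≡⟨ cong (∑ f) (sym (m+[n∸m]≡n (<⇒≤ P<q))) ⟩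
  ∑ f (P + D)                            ≡⟨ ∑-split f P D ⟩
  ∑ f P + ∑ (λ k → f (P + k)) D          ≡⟨ cong₂ _+_ (∑-cong P lower) (∑-cong D upper) ⟩
  τ′ P + ∑ (λ k → 𝟙 (k ≟ pred D)) D      ≡⟨ cong₂ _+_ (τ′-pp pp n) (count-point (pred D) D (≤-reflexive (suc-pred D))) ⟩
  suc n + 1                              ≡⟨ +-comm (suc n) 1 ⟩
  suc (suc n)                            ∎
  where
  open ≡-Reasoning
  P = p ^ n
  q = p ^ suc n
  D = q ∸ P
  P<q : P < q
  P<q = pow<pow-suc pp n
  instance
    P≢0 : NonZero P
    P≢0 = m^n≢0 p n {{prime⇒nonZero pp}}
    D≢0 : NonZero D
    D≢0 = >-nonZero (m<n⇒0<n∸m P<q)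
  f : ℕ → ℕ
  f x = 𝟙 (suc x ∣? q)
  lower : ∀ x → x < P → f x ≡ 𝟙 (suc x ∣? P)
  lower x x<P = 𝟙-⇔ to (λ x+1∣P → ∣-trans x+1∣P (pow-∣ p (n≤1+n n))) (suc x ∣? q) (suc x ∣? P)
    where
    to : suc x ∣ q → suc x ∣ P
    to x+1∣q with pow-divisor-step pp n x+1∣q
    ... | inj₁ x+1∣P = x+1∣P
    ... | inj₂ x+1≡q = ⊥-elim (<⇒≢ (≤-<-trans x<P P<q) x+1≡q)
  upper : ∀ k → k < D → f (P + k) ≡ 𝟙 (k ≟ pred D)
  upper k _ = 𝟙-⇔ to from (suc (P + k) ∣? q) (k ≟ pred D)
    where
    to : suc (P + k) ∣ q → k ≡ pred D
    to d∣q with pow-divisor-step pp n d∣q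
    ... | inj₁ d∣P = ⊥-elim (<⇒≱ (s≤s (m≤m+n P k)) (∣⇒≤ d∣P))
    ... | inj₂ d≡q = cong pred (sym (begin
      D                 ≡⟨ cong (_∸ P) (sym d≡q) ⟩
      suc (P + k) ∸ P   ≡⟨ cong (_∸ P) (sym (+-suc P k)) ⟩
      P + suc k ∸ P     ≡⟨ m+n∸m≡n P (suc k) ⟩
      suc k             ∎))
    from : k ≡ pred D → suc (P + k) ∣ q
    from refl = ∣-reflexive (begin
      suc (P + pred D)  ≡⟨ sym (+-suc P (pred D)) ⟩
      P + suc (pred D)  ≡⟨ cong (P +_) (suc-pred D) ⟩
      P + D             ≡⟨ m+[n∸m]≡n (<⇒≤ P<q) ⟩
      q                 ∎)

τ′-pp-square : ∀ {p} → Prime p → ∀ e → τ′ (p ^ suc e * p ^ suc e) ≡ 3 + 2 * e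
τ′-pp-square {p} pp e = begin
  τ′ (p ^ suc e * p ^ suc e)  ≡⟨ cong τ′ (sym (^-distribˡ-+-* p (suc e) (suc e))) ⟩
  τ′ (p ^ (suc e + suc e))    ≡⟨ τ′-pp pp (suc e + suc e) ⟩
  suc (suc e + suc e)         ≡⟨ solve 1 (λ e → con 1 :+ ((con 1 :+ e) :+ (con 1 :+ e)) := con 3 :+ con 2 :* e) refl e ⟩
  3 + 2 * e                   ∎
  where open ≡-Reasoning

IsRoot : ℕ → ℕ → Set
IsRoot n k = gcd k n ≡ 1 × n ∣ k * k ∸ 1

root? : ∀ n k → Dec (IsRoot n k)
root? n k = (gcd k n ≟ 1) ×-dec (n ∣? k * k ∸ 1)

rootCount : ℕ → ℕ
rootCount n = ∑ (𝟙 ∘ root? n) n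

-- gcd(k² - 1, p^(e+1)) = gcd(k² - 1, p^e) + [p^(e+1) ∣ k² - 1] φ(p^(e+1)) splits
-- S(p^(e+1)) into a sum modulo p^e and a count of square roots of 1.
S′-pp-split : ∀ {p} → Prime p → ∀ e →
  S′ (p ^ suc e) ≡ ∑ (λ k → unit (p ^ suc e) k * gcd (k * k ∸ 1) (p ^ e)) (p ^ suc e) + φ′ (p ^ suc e) * rootCount (p ^ suc e)
S′-pp-split {p} pp e = begin
  ∑ (λ k → unit q k * gcd (x k) q) q                                ≡⟨ ∑-cong q (λ k _ → cong (unit q k *_) (gcd-pow-step pp (x k) e)) ⟩
  ∑ (λ k → unit q k * (gcd (x k) (p ^ e) + 𝟙 (q ∣? x k) * gap)) q   ≡⟨ ∑-cong q (λ k _ → distribute k) ⟩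
  ∑ (λ k → lowerTerm k + 𝟙 (root? q k) * gap) q                     ≡⟨ ∑-+ lowerTerm (λ k → 𝟙 (root? q k) * gap) q ⟩
  ∑ lowerTerm q + ∑ (λ k → 𝟙 (root? q k) * gap) q                   ≡⟨ cong (∑ lowerTerm q +_) (∑-*ʳ gap (𝟙 ∘ root? q) q) ⟩
  ∑ lowerTerm q + rootCount q * gap                                 ≡⟨ cong (∑ lowerTerm q +_) (trans (*-comm (rootCount q) gap) (cong (_* rootCount q) (φ′-pp-gap pp e))) ⟩
  ∑ lowerTerm q + φ′ q * rootCount q                                ∎
  where
  open ≡-Reasoning
  q = p ^ suc e
  gap = q ∸ p ^ e
  x : ℕ → ℕ
  x k = k * k ∸ 1
  lowerTerm : ℕ → ℕ
  lowerTerm k = unit q k * gcd (x k) (p ^ e)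
  distribute : ∀ k → unit q k * (gcd (x k) (p ^ e) + 𝟙 (q ∣? x k) * gap) ≡ lowerTerm k + 𝟙 (root? q k) * gap
  distribute k = trans (*-distribˡ-+ (unit q k) _ _) (cong (lowerTerm k +_)
    (trans (sym (*-assoc (unit q k) (𝟙 (q ∣? x k)) gap)) (cong (_* gap) (sym (𝟙-× (gcd k q ≟ 1) (q ∣? x k))))))

-- Modulo p every unit contributes gcd(k² - 1, 1) = 1 to the first part.
S′-prime : ∀ {p} → Prime p → S′ (p ^ 1) ≡ φ′ (p ^ 1) * suc (rootCount (p ^ 1))
S′-prime {p} pp = begin
  S′ (p ^ 1)                                                     ≡⟨ S′-pp-split pp 0 ⟩
  ∑ (λ k → unit (p ^ 1) k * gcd (k * k ∸ 1) 1) (p ^ 1) + φ′ (p ^ 1) * rootCount (p ^ 1)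
                                                                 ≡⟨ cong (_+ φ′ (p ^ 1) * rootCount (p ^ 1))
                                                                      (∑-cong (p ^ 1) (λ k _ → trans (cong (unit (p ^ 1) k *_) (gcd-zeroʳ (k * k ∸ 1))) (*-identityʳ _))) ⟩
  φ′ (p ^ 1) + φ′ (p ^ 1) * rootCount (p ^ 1)                    ≡⟨ sym (*-suc (φ′ (p ^ 1)) (rootCount (p ^ 1))) ⟩
  φ′ (p ^ 1) * suc (rootCount (p ^ 1))                           ∎
  where open ≡-Reasoning

-- Modulo p^(e+2), the first part is p copies of S(p^(e+1)): whether k is a unit
-- only depends on k mod p, and the summand of S(p^(e+1)) is p^(e+1)-periodic.
S′-pp-lower : ∀ {p} → Prime p → ∀ e →
  ∑ (λ k → unit (p ^ suc (suc e)) k * gcd (k * k ∸ 1) (p ^ suc e)) (p ^ suc (suc e)) ≡ p * S′ (p ^ suc e)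
S′-pp-lower {p} pp e = trans (∑-cong (p * N) (λ k _ → cong (_* gcd (k * k ∸ 1) N) (trans (unit-pp pp (suc e) k) (sym (unit-pp pp e k)))))
                             (∑-periodic (summand N) N (summand-periodic N) p)
  where
  N = p ^ suc e
  instance
    N≢0 : NonZero N
    N≢0 = m^n≢0 p (suc e) {{prime⇒nonZero pp}}

-- `Average n c`: S(n) = φ(n) c, i.e. gcd(k² - 1, n) has average c over the units k.
Average : ℕ → ℕ → Set
Average n c = S′ n ≡ φ′ n * c

Average-mult : ∀ a b .{{_ : NonZero a}} .{{_ : NonZero b}} → Coprime a b → ∀ {c d} → Average a c → Average b d → Average (a * b) (c * d)
Average-mult a b cab {c} {d} avg-a avg-b = begin
  S′ (a * b)                ≡⟨ S′-mult a b cab ⟩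
  S′ a * S′ b               ≡⟨ cong₂ _*_ avg-a avg-b ⟩
  (φ′ a * c) * (φ′ b * d)   ≡⟨ solve 4 (λ x c y d → (x :* c) :* (y :* d) := (x :* y) :* (c :* d)) refl (φ′ a) c (φ′ b) d ⟩
  (φ′ a * φ′ b) * (c * d)   ≡⟨ cong (_* (c * d)) (sym (φ′-mult a b cab)) ⟩
  φ′ (a * b) * (c * d)      ∎
  where open ≡-Reasoning

Average-pp-step : ∀ {p} → Prime p → ∀ e {c} → Average (p ^ suc e) c →
  Average (p ^ suc (suc e)) (c + rootCount (p ^ suc (suc e)))
Average-pp-step {p} pp e {c} avg = begin
  S′ q′                                         ≡⟨ S′-pp-split pp (suc e) ⟩
  _ + φ′ q′ * R                                 ≡⟨ cong (_+ φ′ q′ * R) (S′-pp-lower pp e) ⟩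
  p * S′ q + φ′ q′ * R                          ≡⟨ cong (λ s → p * s + φ′ q′ * R) avg ⟩
  p * (φ′ q * c) + φ′ q′ * R                    ≡⟨ cong (_+ φ′ q′ * R) (trans (sym (*-assoc p (φ′ q) c)) (cong (_* c) (sym (φ′-pp-step pp e)))) ⟩
  φ′ q′ * c + φ′ q′ * R                         ≡⟨ sym (*-distribˡ-+ (φ′ q′) c R) ⟩
  φ′ q′ * (c + R)                               ∎
  where
  open ≡-Reasoning
  q = p ^ suc e
  q′ = p ^ suc (suc e)
  R = rootCount q′

square-minus-one : ∀ k → suc k * suc k ∸ 1 ≡ k * suc (suc k)
square-minus-one k = solve 1 (λ k → k :+ k :* (con 1 :+ k) := k :* (con 2 :+ k)) refl k

-- n - 1 is a square root of 1 modulo n: (n - 1)² - 1 = (n - 2) n.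
n∣[n-1]²-1 : ∀ n → n ∣ pred n * pred n ∸ 1
n∣[n-1]²-1 zero          = 0 ∣0
n∣[n-1]²-1 (suc zero)    = 1 ∣0
n∣[n-1]²-1 (suc (suc n)) = divides n (square-minus-one n)

-- Modulo an odd prime power q, the only square roots of 1 below q are 1 and
-- q - 1: p divides at most one of k - 1 and k + 1, so q divides the other.
odd-pp-roots : ∀ {p} → Prime p → p ≢ 2 → ∀ e k → k < p ^ suc e → IsRoot (p ^ suc e) k → k ≡ 1 ⊎ suc k ≡ p ^ suc e
odd-pp-roots {p} pp p≢2 e zero _ (unit , _) = ⊥-elim (<⇒≢ (≤-trans (prime>1 pp) (p≤p^suc pp e)) (sym (trans (sym (gcd-identityˡ _)) unit)))
odd-pp-roots {p} pp p≢2 e (suc k) k<q (_ , q∣) with p ∣? k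
... | no p∤k = inj₂ (≤-antisym k<q (∣⇒≤ (prime-power-∣ pp p∤k (suc e) (subst (p ^ suc e ∣_) (square-minus-one k) q∣))))
... | yes p∣k = inj₁ (cong suc (∣-small (prime-power-∣ pp p∤k+2 (suc e) (subst (p ^ suc e ∣_) (trans (square-minus-one k) (*-comm k _)) q∣))
                                         (<-trans (n<1+n k) k<q)))
  where
  p∤k+2 : ¬ p ∣ suc (suc k)
  p∤k+2 p∣k+2 = p≢2 (≤-antisym (∣⇒≤ (∣m+n∣m⇒∣n (subst (p ∣_) (+-comm 2 k) p∣k+2) p∣k)) (prime>1 pp))

count-two : ∀ {P : ℕ → Set} (P? : ∀ k → Dec (P k)) n → 3 ≤ n → (∀ k → k < n → P k → k ≡ 1 ⊎ suc k ≡ n) →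
  P 1 → P (pred n) → ∑ (𝟙 ∘ P?) n ≡ 2
count-two P? (suc zero)       (s≤s ())       _ _ _
count-two P? (suc (suc zero)) (s≤s (s≤s ())) _ _ _
count-two P? n@(suc (suc (suc _))) _ only-roots P1 Pn-1 =
  count-by-listing P? n (1 ∷ pred n ∷ []) (s≤s (s≤s z≤n) ∷ [-]) (s≤s (s≤s z≤n) ∷ ≤-refl ∷ []) (P1 ∷ Pn-1 ∷ []) complete
  where
  complete : ∀ k → k < n → _ → k ∈ 1 ∷ pred n ∷ []
  complete k k<n Pk with only-roots k k<n Pk
  ... | inj₁ refl = here refl
  ... | inj₂ refl = there (here refl)

rootCount-odd : ∀ {p} → Prime p → p ≢ 2 → ∀ e → rootCount (p ^ suc e) ≡ 2
rootCount-odd {p} pp p≢2 e = count-two (root? q) q 3≤q (odd-pp-roots pp p≢2 e) (gcd-zeroˡ q , q ∣0) (unit-last , n∣[n-1]²-1 q)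
  where
  q = p ^ suc e
  instance
    q≢0 : NonZero q
    q≢0 = m^n≢0 p (suc e) {{prime⇒nonZero pp}}
  3≤q : 3 ≤ q
  3≤q = ≤-trans (≤∧≢⇒< (prime>1 pp) (p≢2 ∘ sym)) (p≤p^suc pp e)
  p∤q-1 : ¬ p ∣ pred q
  p∤q-1 p∣q-1 = <⇒≢ (prime>1 pp) (sym (∣1⇒≡1 (∣m+n∣m⇒∣n p∣q-1+1 p∣q-1)))
    where
    p∣q-1+1 : p ∣ pred q + 1
    p∣q-1+1 = subst (p ∣_) (sym (trans (+-comm (pred q) 1) (suc-pred q))) (m∣m*n (p ^ e))
  unit-last : gcd (pred q) q ≡ 1
  unit-last = prime-to-p⇒unit pp p∤q-1 (suc e)

odd-form : ∀ k → ¬ 2 ∣ k → ∃[ m ] k ≡ suc (2 * m)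
odd-form zero          2∤0 = ⊥-elim (2∤0 (2 ∣0))
odd-form (suc zero)    _   = 0 , refl
odd-form (suc (suc k)) 2∤k+2 with odd-form k (λ 2∣k → 2∤k+2 (∣m∣n⇒∣m+n (∣-refl {2}) 2∣k))
... | m , refl = suc m , cong (suc ∘ suc) (sym (+-suc m (m + 0)))

odd-not-even : ∀ m → ¬ 2 ∣ suc (2 * m)
odd-not-even m (divides q eq) = even≢odd q m (trans (*-comm 2 q) (sym eq))

odd-square-minus-one : ∀ m → suc (2 * m) * suc (2 * m) ∸ 1 ≡ 2 * (2 * (m * suc m))
odd-square-minus-one m = solve 1 (λ m → con 2 :* m :+ con 2 :* m :* (con 1 :+ con 2 :* m) := con 2 :* (con 2 :* (m :* (con 1 :+ m)))) refl m

odd-mono : ∀ {m n} → m < n → suc (2 * m) < suc (2 * n)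
odd-mono m<n = s<s (*-monoʳ-< 2 m<n)

odd<2n : ∀ {m n} → m < n → suc (2 * m) < 2 * n
odd<2n {m} {n} m<n = subst (_≤ 2 * n) (cong suc (+-suc m (m + 0))) (*-monoʳ-≤ 2 m<n)

odd<2n⁻¹ : ∀ {m n} → suc (2 * m) < 2 * n → m < n
odd<2n⁻¹ {m} {n} lt = *-cancelˡ-< 2 m n (<-trans (n<1+n (2 * m)) lt)

multiples≤2g : ∀ {g x} .{{_ : NonZero g}} → g ∣ x → x ≤ 2 * g → x ≡ 0 ⊎ x ≡ g ⊎ x ≡ 2 * g
multiples≤2g     (divides zero refl)                _    = inj₁ refl
multiples≤2g {g} (divides (suc zero) refl)          _    = inj₂ (inj₁ (+-identityʳ g))
multiples≤2g     (divides (suc (suc zero)) refl)    _    = inj₂ (inj₂ refl)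
multiples≤2g {g} (divides (suc (suc (suc q))) refl) x≤2g = ⊥-elim (<⇒≱ (*-monoˡ-< g {2} {3 + q} (s≤s (s≤s (s≤s z≤n)))) x≤2g)

-- For g = 2^n: if m < 2g and g ∣ m (m + 1), then m or m + 1 is 0, g or 2g,
-- since g divides whichever of m, m + 1 is even.
two-power-root-cases : ∀ n m → m < 2 * 2 ^ n → 2 ^ n ∣ m * suc m → m ≡ 0 ⊎ suc m ≡ 2 ^ n ⊎ m ≡ 2 ^ n ⊎ suc m ≡ 2 * 2 ^ n
two-power-root-cases n m m<2g g∣ with 2 ∣? m
... | yes 2∣m with multiples≤2g {{m^n≢0 2 n}} (prime-power-∣ prime[2] 2∤m+1 n (subst (2 ^ n ∣_) (*-comm m (suc m)) g∣)) (<⇒≤ m<2g)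
  where
  2∤m+1 : ¬ 2 ∣ suc m
  2∤m+1 2∣m+1 = >⇒∤ (s≤s (s≤s z≤n)) (∣m+n∣m⇒∣n (subst (2 ∣_) (+-comm 1 m) 2∣m+1) 2∣m)
...   | inj₁ m≡0         = inj₁ m≡0
...   | inj₂ (inj₁ m≡g)  = inj₂ (inj₂ (inj₁ m≡g))
...   | inj₂ (inj₂ m≡2g) = ⊥-elim (<⇒≢ m<2g m≡2g)
two-power-root-cases n m m<2g g∣ | no 2∤m with multiples≤2g {{m^n≢0 2 n}} (prime-power-∣ prime[2] 2∤m n g∣) m<2g
... | inj₂ (inj₁ m+1≡g)  = inj₂ (inj₁ m+1≡g)
... | inj₂ (inj₂ m+1≡2g) = inj₂ (inj₂ (inj₂ m+1≡2g))

-- Modulo 2^(e+3) = 4g the square roots of 1 are 1, 2g - 1, 2g + 1 and 4g - 1: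
-- writing k = 2m + 1, k² - 1 = 4 m (m + 1), so 4g ∣ k² - 1 iff g ∣ m (m + 1).
rootCount-2pow : ∀ e → rootCount (2 ^ suc (suc (suc e))) ≡ 4
rootCount-2pow e = count-by-listing (root? Q) Q roots increasing below are-roots complete
  where
  g = 2 ^ suc e
  Q = 2 ^ suc (suc (suc e))
  instance
    g≢0 : NonZero g
    g≢0 = m^n≢0 2 (suc e)
  odd : ℕ → ℕ
  odd m = suc (2 * m)
  roots : List ℕ
  roots = odd 0 ∷ odd (pred g) ∷ odd g ∷ odd (pred (2 * g)) ∷ []
  2≤g : 2 ≤ g
  2≤g = *-monoʳ-≤ 2 (m^n>0 2 e)
  g<2g : g < 2 * g
  g<2g = subst (g <_) (*-comm g 2) (m<m*n g 2 (s≤s (s≤s z≤n)))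
  pred<self : ∀ n .{{_ : NonZero n}} → pred n < n
  pred<self n = ≤-reflexive (suc-pred n)
  2g≢0 : NonZero (2 * g)
  2g≢0 = m*n≢0 2 g
  g<pred[2g] : g < pred (2 * g)
  g<pred[2g] = suc[m]≤n⇒m≤pred[n] (subst (2 + g ≤_) (cong (g +_) (sym (+-identityʳ g))) (+-monoˡ-≤ g 2≤g))
  increasing : Linked _<_ roots
  increasing = odd-mono (pred-mono-≤ 2≤g) ∷ odd-mono (pred<self g) ∷ odd-mono g<pred[2g] ∷ [-]
  below : All (_< Q) roots
  below = odd<2n (<-trans (m^n>0 2 (suc e)) g<2g) ∷ odd<2n (<-trans (pred<self g) g<2g) ∷ odd<2n g<2g ∷ odd<2n (pred<self (2 * g) {{2g≢0}}) ∷ []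
  root-of : ∀ m → g ∣ m * suc m → IsRoot Q (odd m)
  root-of m g∣ = prime-to-p⇒unit prime[2] (odd-not-even m) (suc (suc (suc e))) ,
                 subst (Q ∣_) (sym (odd-square-minus-one m)) (*-monoʳ-∣ 2 (*-monoʳ-∣ 2 g∣))
  are-roots : All (IsRoot Q) roots
  are-roots = root-of 0 (g ∣0)
            ∷ root-of (pred g) (subst (λ s → g ∣ pred g * s) (sym (suc-pred g)) (n∣m*n (pred g)))
            ∷ root-of g (m∣m*n (suc g))
            ∷ root-of (pred (2 * g)) (subst (λ s → g ∣ pred (2 * g) * s) (sym (suc-pred (2 * g) {{2g≢0}})) (∣n⇒∣m*n (pred (2 * g)) (n∣m*n 2)))
            ∷ []
  candidate : ∀ m → m ≡ 0 ⊎ suc m ≡ g ⊎ m ≡ g ⊎ suc m ≡ 2 * g → odd m ∈ roots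
  candidate m (inj₁ m≡0)                  = here (cong odd m≡0)
  candidate m (inj₂ (inj₁ m+1≡g))         = there (here (cong (odd ∘ pred) m+1≡g))
  candidate m (inj₂ (inj₂ (inj₁ m≡g)))    = there (there (here (cong odd m≡g)))
  candidate m (inj₂ (inj₂ (inj₂ m+1≡2g))) = there (there (there (here (cong (odd ∘ pred) m+1≡2g))))
  complete : ∀ k → k < Q → IsRoot Q k → k ∈ roots
  complete k k<Q (unit , Q∣) = subst (_∈ roots) (sym k≡odd) (candidate m (two-power-root-cases (suc e) m m<2g g∣))
    where
    m = proj₁ (odd-form k (unit⇒prime-to-p prime[2] (suc (suc e)) unit))
    k≡odd : k ≡ odd m
    k≡odd = proj₂ (odd-form k (unit⇒prime-to-p prime[2] (suc (suc e)) unit))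
    m<2g : m < 2 * g
    m<2g = odd<2n⁻¹ (subst (_< Q) k≡odd k<Q)
    g∣ : g ∣ m * suc m
    g∣ = *-cancelˡ-∣ 2 (*-cancelˡ-∣ 2 (subst (Q ∣_) (trans (cong (λ k → k * k ∸ 1) k≡odd) (odd-square-minus-one m)) Q∣))

-- For an odd prime p: S(p^(e+1)) = (2e + 3) φ(p^(e+1)), two roots of 1 being added at each step.
Average-odd-pp : ∀ {p} → Prime p → p ≢ 2 → ∀ e → Average (p ^ suc e) (3 + 2 * e)
Average-odd-pp {p} pp p≢2 zero    = trans (S′-prime pp) (cong (λ R → φ′ (p ^ 1) * suc R) (rootCount-odd pp p≢2 0))
Average-odd-pp {p} pp p≢2 (suc e) = trans (Average-pp-step pp e (Average-odd-pp pp p≢2 e))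
  (cong (φ′ (p ^ suc (suc e)) *_) (trans (cong (3 + 2 * e +_) (rootCount-odd pp p≢2 (suc e)))
                                         (solve 1 (λ e → con 3 :+ con 2 :* e :+ con 2 := con 3 :+ con 2 :* (con 1 :+ e)) refl e)))

-- S(2^(l+2)) = 4(l + 1) φ(2^(l+2)), four roots of 1 being added at each step from 8 on.
Average-2pow : ∀ l → Average (2 ^ suc (suc l)) (4 * suc l)
Average-2pow zero    = refl
Average-2pow (suc l) = trans (Average-pp-step prime[2] (suc l) (Average-2pow l))
  (cong (φ′ (2 ^ suc (suc (suc l))) *_) (trans (cong (4 * suc l +_) (rootCount-2pow l))
                                               (solve 1 (λ l → con 4 :* (con 1 :+ l) :+ con 4 := con 4 :* (con 2 :+ l)) refl l)))

coprime-squares : ∀ {a b} → Coprime a b → Coprime (a * a) (b * b)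
coprime-squares {a} {b} cab = coprime-* a*a⊥b a*a⊥b
  where
  a*a⊥b : Coprime (a * a) b
  a*a⊥b = coprime-sym (coprime-* (coprime-sym cab) (coprime-sym cab))

τ′-squares-mult : ∀ a b .{{_ : NonZero a}} .{{_ : NonZero b}} → Coprime a b → τ′ (a * a) * τ′ (b * b) ≡ τ′ ((a * b) * (a * b))
τ′-squares-mult a b cab = begin
  τ′ (a * a) * τ′ (b * b)     ≡⟨ sym (τ′-mult (a * a) (b * b) {{m*n≢0 a a}} {{m*n≢0 b b}} (coprime-squares cab)) ⟩
  τ′ ((a * a) * (b * b))      ≡⟨ cong τ′ (solve 2 (λ a b → (a :* a) :* (b :* b) := (a :* b) :* (a :* b)) refl a b) ⟩
  τ′ ((a * b) * (a * b))      ∎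
  where open ≡-Reasoning

prime-divisor : ∀ m → 2 ≤ m → ∃[ p ] (Prime p × p ∣ m)
prime-divisor m@(suc _) 2≤m with factorise m
... | record { factors = [] ; isFactorisation = m≡1 } = ⊥-elim (<⇒≢ 2≤m (sym m≡1))
... | record { factors = p ∷ ps ; isFactorisation = m≡ ; factorsPrime = pp ∷ _ } =
  p , pp , divides (product ps) (trans m≡ (*-comm p (product ps)))

split-prime-power : ∀ {p} → Prime p → ∀ m → 0 < m → p ∣ m → ∃[ e ] ∃[ r ] (m ≡ p ^ suc e * r × ¬ p ∣ r)
split-prime-power {p} pp = <-rec Goal step
  where
  Goal : ℕ → Set
  Goal m = 0 < m → p ∣ m → ∃[ e ] ∃[ r ] (m ≡ p ^ suc e * r × ¬ p ∣ r)
  step : ∀ m → (∀ {m′} → m′ < m → Goal m′) → Goal m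
  step _ _   ()  (divides zero refl)
  step _ rec _   (divides q@(suc _) refl) with p ∣? q
  ... | no p∤q  = 0 , q , trans (*-comm q p) (cong (_* q) (sym (*-identityʳ p))) , p∤q
  ... | yes p∣q with rec (m<m*n q p (prime>1 pp)) z<s p∣q
  ...   | e , r , q≡ , p∤r = suc e , r , trans (cong (_* p) q≡) (solve 3 (λ P r p → P :* r :* p := p :* P :* r) refl (p ^ suc e) r p) , p∤r

prime-power-induction : (P : ℕ → Set) → P 1 →
  (∀ {p} e r → Prime p → ¬ p ∣ r → 0 < r → P r → P (p ^ suc e * r)) → ∀ m → 0 < m → P m
prime-power-induction P P1 extend = <-rec (λ m → 0 < m → P m) go
  where
  go : ∀ m → (∀ {m′} → m′ < m → 0 < m′ → P m′) → 0 < m → P m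
  go (suc zero) _ _ = P1
  go m@(suc (suc _)) rec _ with prime-divisor m (s≤s (s≤s z≤n))
  ... | p , pp , p∣m with split-prime-power pp m z<s p∣m
  ...   | e , r , m≡ , p∤r = subst P (sym m≡) (extend e r pp p∤r 0<r (rec r<m 0<r))
    where
    0<r : 0 < r
    0<r = n≢0⇒n>0 (λ r≡0 → 0≢1+n (sym (trans m≡ (trans (cong (p ^ suc e *_) r≡0) (*-zeroʳ (p ^ suc e))))))
    r<m : r < m
    r<m = subst (r <_) (trans (*-comm r (p ^ suc e)) (sym m≡))
            (m<m*n r (p ^ suc e) {{>-nonZero 0<r}} (≤-trans (prime>1 pp) (p≤p^suc pp e)))

odd⇒0< : ∀ {m} → Odd m → 0 < m
odd⇒0< {zero}  odd = ⊥-elim (odd (2 ∣0))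
odd⇒0< {suc _} _   = z<s

-- For odd m, S(m) = φ(m) τ(m²): true for m = 1, for odd prime powers p^(e+1) since
-- τ(p^(2e+2)) = 2e + 3, and preserved by coprime products.
Average-odd : ∀ m → 0 < m → Odd m → Average m (τ′ (m * m))
Average-odd = prime-power-induction (λ m → Odd m → Average m (τ′ (m * m))) (λ _ → refl) extend
  where
  extend : ∀ {p} e r → Prime p → ¬ p ∣ r → 0 < r → (Odd r → Average r (τ′ (r * r))) →
    Odd (p ^ suc e * r) → Average (p ^ suc e * r) (τ′ ((p ^ suc e * r) * (p ^ suc e * r)))
  extend {p} e r pp p∤r 0<r avg-r odd = subst (Average (q * r)) (τ′-squares-mult q r coprime)
    (Average-mult q r coprime (subst (Average q) (sym (τ′-pp-square pp e)) (Average-odd-pp pp p≢2 e)) (avg-r odd-r))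
    where
    q = p ^ suc e
    instance
      q≢0 : NonZero q
      q≢0 = m^n≢0 p (suc e) {{prime⇒nonZero pp}}
      r≢0 : NonZero r
      r≢0 = >-nonZero 0<r
    coprime : Coprime q r
    coprime = coprime-sym (coprime-^ p (suc e) (coprime-sym (prime-coprime pp p∤r)))
    p≢2 : p ≢ 2
    p≢2 refl = odd (∣m⇒∣m*n r (m∣m*n (2 ^ e)))
    odd-r : Odd r
    odd-r 2∣r = odd (∣n⇒∣m*n q 2∣r)

S-from-Average : ∀ n c → 0 < n → Average n c → S n ≡ φ n * c
S-from-Average n c 0<n avg = trans (S≡S′ n) (trans avg (cong (_* c) (sym (φ≡φ′ n))))
  where
  instance
    n≢0 : NonZero n
    n≢0 = >-nonZero 0<n

-- The three cases of the corollary; the even cases multiply the odd average by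
-- the average 2 of S(2) = 2 φ(2), resp. 4(ℓ - 1) of 2^ℓ.
S-odd : ∀ m → Odd m → S m ≡ φ m * τ (m * m)
S-odd m odd = trans (S-from-Average m (τ′ (m * m)) (odd⇒0< odd) (Average-odd m (odd⇒0< odd) odd)) (cong (φ m *_) (sym (τ≡τ′ (m * m))))

S-twice-odd : ∀ m → Odd m → S (2 * m) ≡ φ (2 * m) * (2 * τ (m * m))
S-twice-odd m odd = trans (S-from-Average (2 * m) _ (*-monoʳ-< 2 (odd⇒0< odd)) average) (cong (λ t → φ (2 * m) * (2 * t)) (sym (τ≡τ′ (m * m))))
  where
  instance
    m≢0 : NonZero m
    m≢0 = >-nonZero (odd⇒0< odd)
  average : Average (2 * m) (2 * τ′ (m * m))
  average = Average-mult 2 m (prime-coprime prime[2] odd) refl (Average-odd m (odd⇒0< odd) odd)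

S-power-of-two-times-odd : ∀ ℓ m → 2 ≤ ℓ → Odd m → S (2 ^ ℓ * m) ≡ φ (2 ^ ℓ * m) * (4 * (ℓ ∸ 1) * τ (m * m))
S-power-of-two-times-odd (suc zero)        m (s≤s ()) _
S-power-of-two-times-odd ℓ@(suc (suc l)) m _ odd =
  trans (S-from-Average (2 ^ ℓ * m) _ (>-nonZero⁻¹ (2 ^ ℓ * m)) average) (cong (λ t → φ (2 ^ ℓ * m) * (4 * suc l * t)) (sym (τ≡τ′ (m * m))))
  where
  instance
    2^ℓ≢0 : NonZero (2 ^ ℓ)
    2^ℓ≢0 = m^n≢0 2 ℓ
    m≢0 : NonZero m
    m≢0 = >-nonZero (odd⇒0< odd)
    2^ℓm≢0 : NonZero (2 ^ ℓ * m)
    2^ℓm≢0 = m*n≢0 (2 ^ ℓ) m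
  average : Average (2 ^ ℓ * m) (4 * suc l * τ′ (m * m))
  average = Average-mult (2 ^ ℓ) m (coprime-sym (coprime-^ 2 ℓ (coprime-sym (prime-coprime prime[2] odd))))
              (Average-2pow l) (Average-odd m (odd⇒0< odd) odd)

corollary15 :
    (∀ (m : ℕ) → Odd m → S m ≡ φ m * τ (m * m))
    × (∀ (m : ℕ) → Odd m → S (2 * m) ≡ φ (2 * m) * (2 * τ (m * m)))
    × (∀ (ℓ m : ℕ) → 2 ≤ ℓ → Odd m → S (2 ^ ℓ * m) ≡ φ (2 ^ ℓ * m) * (4 * (ℓ ∸ 1) * τ (m * m)))
corollary15 = S-odd , S-twice-odd , S-power-of-two-times-odd
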